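{- Let $\mathbf{p}=p_{n-1}\dots p_0$ be an $(m,n)$-parking function, extended periodically by $p(i+kn)=p_i$ for $0\le i\le n-1$, $k\ge0$. Let $U:\mathbb{Z}_{\ge0}\to\mathbb{Z}_{\ge0}\cup\{\infty\}$ be produced by Algorithm 1 and $V:\mathbb{Z}_{\ge0}\to\mathbb{Z}_{\ge0}$ by Algorithm 2 (described in the context). Then $U(i)=V(i)$ for all $i\in\mathbb{Z}_{\ge0}$.
   Context: An $(m,n)$-parking function is $\mathbf{p}=p_{n-1}\dots p_0\in\{0,\dots,m-1\}^n$ with $\#\{j:p_j<i\}\ge in/m$ for $1\le i\le m$. Algorithm 1: the values $0,1,2,\dots$ are placed one at a time into positions $i\in\mathbb{Z}_{\ge0}$, each position receiving at most one value; $U(i)$ is the value placed in position $i$ ($\infty$ if none ever is), and $U^{ -1}(\beta)$ denotes the position of an already placed value $\beta$. First place $0$ in position $\min\{j:p(j)=0\}$. Having placed $0,\dots,\alpha-1$, place $\alpha$ in the leftmost (smallest) unoccupied position $i$ such that (1) $i>U^{ -1}(\alpha-m)$ (a vacuous condition if $\alpha<m$), and (2) $p(i)=\#\{\beta: \alpha-m<\beta<\alpha,\ \beta\ge0,\ U^{ -1}(\beta)>i\}$. Algorithm 2: let $S_0=\{0,1,\dots,m-1\}$; for $i\ge0$, let $V(i)$ be the $p(i)$-th smallest element of $S_i$ (indexing from $0$) and $S_{i+1}=(S_i\setminus\{V(i)\})\cup\{V(i)+m\}$. -}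

module Defs where

open import Data.Nat using (ℕ; zero; suc; _+_; _*_; _∸_; _≤_; _<_; _≤?_; _<?_; NonZero)
open import Data.Nat.DivMod using (_mod_)
open import Data.Fin using (Fin; toℕ)
open import Data.List using (List; []; _∷_; length; filter; upTo; allFin)
open import Data.Product using (_×_)
open import Relation.Nullary.Decidable using (_×-dec_)
open import Relation.Binary.PropositionalEquality using (_≡_; _≢_)
open import Relation.Nullary using (¬_)

countBelow : ∀ {m n} → (Fin n → Fin m) → ℕ → ℕ
countBelow {n = n} p i = length (filter (λ j → suc (toℕ (p j)) ≤? i) (allFin n))

-- (m,n)-parking function: #{j : p_j < i} ≥ i n / m for 1 ≤ i ≤ m,
-- written without division as  i * n ≤ m * #{j : p_j < i}.
IsParking : (m n : ℕ) → (Fin n → Fin m) → Set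
IsParking m n p = ∀ i → 1 ≤ i → i ≤ m → i * n ≤ m * countBelow p i

pext : ∀ {m} n → .{{_ : NonZero n}} → (Fin n → Fin m) → ℕ → ℕ
pext n p i = toℕ (p (i mod n))

-- Algorithm 2 (sets S_i kept as ascending sorted lists)

-- k-th element (from 0) of a list; default 0 (never used: |S_i| = m, p(i) < m).
kth : ℕ → List ℕ → ℕ
kth _ [] = 0
kth zero (x ∷ xs) = x
kth (suc k) (x ∷ xs) = kth k xs

removeKth : ℕ → List ℕ → List ℕ
removeKth _ [] = []
removeKth zero (x ∷ xs) = xs
removeKth (suc k) (x ∷ xs) = x ∷ removeKth k xs

insertSorted : ℕ → List ℕ → List ℕ
insertSorted y [] = y ∷ []
insertSorted y (x ∷ xs) with y ≤? x
... | Relation.Nullary.yes _ = y ∷ x ∷ xs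
... | Relation.Nullary.no _ = x ∷ insertSorted y xs

S₂ : (m : ℕ) → (q : ℕ → ℕ) → ℕ → List ℕ
S₂ m q zero = upTo m
S₂ m q (suc i) = insertSorted (kth (q i) (S₂ m q i) + m) (removeKth (q i) (S₂ m q i))

V₂ : (m : ℕ) → (q : ℕ → ℕ) → ℕ → ℕ
V₂ m q i = kth (q i) (S₂ m q i)

-- Algorithm 1, described relationally by the position map
-- pos α = U⁻¹(α) (position where value α is placed).

countAbove : (m : ℕ) → (pos : ℕ → ℕ) → (α i : ℕ) → ℕ
countAbove m pos α i = length (filter (λ β → (α <? β + m) ×-dec (i <? pos β)) (upTo α))

Unoccupied : (pos : ℕ → ℕ) → (α i : ℕ) → Set
Unoccupied pos α i = ∀ β → β < α → pos β ≢ i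

Admissible : (m : ℕ) → (q : ℕ → ℕ) → (pos : ℕ → ℕ) → (α i : ℕ) → Set
Admissible m q pos α i = (m ≤ α → pos (α ∸ m) < i) × (q i ≡ countAbove m pos α i)

StepOK : (m : ℕ) → (q : ℕ → ℕ) → (pos : ℕ → ℕ) → ℕ → Set
StepOK m q pos α =
  Unoccupied pos α (pos α) × Admissible m q pos α (pos α)
  × (∀ i → i < pos α → Unoccupied pos α i → ¬ Admissible m q pos α i)

Alg1Run : (m : ℕ) → (q : ℕ → ℕ) → (pos : ℕ → ℕ) → Set
Alg1Run m q pos = ∀ α → StepOK m q pos α

{-# OPTIONS --safe #-}
-- Algorithm 2 keeps in S i the least unused value of each residue class mod m, so the number of
-- elements of S i below α equals the number of values in the window [α − m, α) that are not among
-- V 0, …, V (i − 1).  Reading V i = kth (q i) (S i) through this count, V i is the unique value α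
-- that is unused, whose predecessor α − m is already used (or α < m), and whose window holds
-- exactly q i unused values.  In particular V is injective; it is surjective because a value α
-- that is never used forces every zero of q to use up a different value ≤ α, while the parking
-- condition makes q vanish periodically.  Along the inverse pos of V, the three conditions above
-- say exactly that position i is free and admissible for α in Algorithm 1, so pos α is the leftmost
-- such position and pos is a run of Algorithm 1; every run equals it, since each step of
-- Algorithm 1 is determined by the earlier ones.

module Submission where

open import Defs
open import Data.Bool using (Bool; true; false; _∧_; not)
open import Data.Bool.Properties using (∧-zeroʳ; ∧-identityʳ)
open import Data.Fin using (Fin; toℕ)
open import Data.Fin.Properties using (any?; toℕ<n; toℕ-fromℕ<; toℕ-injective)
open import Data.List using (List; []; _∷_; _++_; [_]; length; filter; upTo; allFin)
open import Data.List.Properties using (upTo-∷ʳ; length-upTo; length-++; filter-++; filter-none)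
open import Data.List.Relation.Unary.All as All using (All; []; _∷_)
open import Data.List.Relation.Unary.AllPairs using (AllPairs; []; _∷_)
import Data.List.Relation.Unary.AllPairs.Properties as AllPairs
open import Data.Nat
open import Data.Nat.DivMod using (_mod_; [m+kn]%n≡m%n; m<n⇒m%n≡m)
open import Data.Nat.Induction using (<-rec)
open import Data.Nat.Properties
open import Algebra.Properties.CommutativeSemigroup +-commutativeSemigroup
  using (x∙yz≈y∙xz; x∙yz≈xz∙y; xy∙z≈xz∙y)
open import Data.Product using (Σ; ∃-syntax; _×_; _,_; proj₁; proj₂; uncurry)
open import Data.Sum using (inj₁; inj₂)
open import Function using (_∘_; id; _⇔_; mk⇔; Equivalence)
open import Level using (0ℓ)
open import Relation.Binary.PropositionalEquality hiding ([_])
open import Relation.Binary.Definitions using (tri<; tri≈; tri>)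
open import Relation.Nullary using (Dec; yes; no; does; ¬_; contradiction)
open import Relation.Nullary.Decidable using (dec-true; dec-false)
open import Relation.Unary using (Pred; Decidable)

open ≤-Reasoning

𝟙 : Bool → ℕ
𝟙 true = 1
𝟙 false = 0

𝟙≤1 : ∀ b → 𝟙 b ≤ 1
𝟙≤1 true = ≤-refl
𝟙≤1 false = z≤n

𝟙-does-mono : ∀ {P Q : Set} (P? : Dec P) (Q? : Dec Q) → (P → Q) → 𝟙 (does P?) ≤ 𝟙 (does Q?)
𝟙-does-mono (no _) _ _ = z≤n
𝟙-does-mono (yes _) (yes _) _ = ≤-refl
𝟙-does-mono (yes p) (no ¬q) p⇒q = contradiction (p⇒q p) ¬q

does-cong : ∀ {P Q : Set} (P? : Dec P) (Q? : Dec Q) → (P → Q) → (Q → P) → does P? ≡ does Q?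
does-cong (yes _) (yes _) _ _ = refl
does-cong (yes p) (no ¬q) p⇒q _ = contradiction (p⇒q p) ¬q
does-cong (no ¬p) (yes q) _ q⇒p = contradiction (q⇒p q) ¬p
does-cong (no _) (no _) _ _ = refl

<?≡≤? : ∀ {x y} → x ≢ y → does (x <? y) ≡ does (x ≤? y)
<?≡≤? {x} {y} x≢y = does-cong (x <? y) (x ≤? y) <⇒≤ (λ x≤y → ≤∧≢⇒< x≤y x≢y)

𝟙-<-split : ∀ {x y a} (x<a? : Dec (x < a)) (a≤y? : Dec (a ≤ y)) (y<a? : Dec (y < a)) → x ≤ y →
  𝟙 (does x<a?) ≡ 𝟙 (does a≤y? ∧ does x<a?) + 𝟙 (does y<a?)
𝟙-<-split _        (yes a≤y) (yes y<a) _   = contradiction a≤y (<⇒≱ y<a)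
𝟙-<-split (no x≮a) _         (yes y<a) x≤y = contradiction (≤-<-trans x≤y y<a) x≮a
𝟙-<-split _        (no a≰y)  (no y≮a)  _   = contradiction (≮⇒≥ y≮a) a≰y
𝟙-<-split (yes _)  (yes _)   (no _)    _   = refl
𝟙-<-split (yes _)  (no _)    (yes _)   _   = refl
𝟙-<-split (no _)   (yes _)   (no _)    _   = refl

𝟙-jump : ∀ {w w′ k} u b → w′ + 𝟙 b ≡ w + 𝟙 u → w ≤ k → k < w′ →
  u ≡ true × b ≡ false × w ≡ k
𝟙-jump {w} {w′} false b eq w≤k k<w′ =
  contradiction (≤-trans (m≤m+n w′ (𝟙 b)) (≤-trans (≤-reflexive (trans eq (+-identityʳ w))) w≤k))
                (<⇒≱ k<w′)
𝟙-jump {w} {w′} true true eq w≤k k<w′ =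
  contradiction (≤-trans (≤-reflexive (+-cancelʳ-≡ 1 w′ w eq)) w≤k) (<⇒≱ k<w′)
𝟙-jump {w} {w′} {k} true false eq w≤k k<w′ =
  refl , refl , ≤-antisym w≤k (s≤s⁻¹ (subst (suc k ≤_) w′≡1+w k<w′))
  where
  w′≡1+w : w′ ≡ suc w
  w′≡1+w = trans (sym (+-identityʳ w′)) (trans eq (+-comm w 1))

count : (ℕ → Bool) → ℕ → ℕ
count f zero = 0
count f (suc k) = count f k + 𝟙 (f k)

count-cong : ∀ {f g} k → (∀ β → β < k → f β ≡ g β) → count f k ≡ count g k
count-cong zero _ = refl
count-cong (suc k) f≗g =
  cong₂ _+_ (count-cong k (λ β β<k → f≗g β (m<n⇒m<1+n β<k))) (cong 𝟙 (f≗g k (n<1+n k)))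

count-remove : ∀ {f g v} k → v < k → g v ≡ false → (∀ β → β ≢ v → g β ≡ f β) →
  count f k ≡ count g k + 𝟙 (f v)
count-remove {f} {g} {v} (suc k) v<1+k gv≡false g≗f with v ≟ k
... | yes refl rewrite gv≡false | +-identityʳ (count g v) =
  cong (_+ 𝟙 (f v)) (count-cong v (λ β β<v → sym (g≗f β (<⇒≢ β<v))))
... | no v≢k rewrite g≗f k (≢-sym v≢k) =
  trans (cong (_+ 𝟙 (f k)) (count-remove k (≤∧≢⇒< (m<1+n⇒m≤n v<1+k) v≢k) gv≡false g≗f))
        (xy∙z≈xz∙y (count g k) (𝟙 (f v)) (𝟙 (f k)))

count-mono : ∀ f {a b} → a ≤ b → count f a ≤ count f b
count-mono f {b = zero} z≤n = z≤n
count-mono f {a} {suc b} a≤1+b with m≤n⇒m<n∨m≡n a≤1+b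
... | inj₁ a<1+b = ≤-trans (count-mono f (m<1+n⇒m≤n a<1+b)) (m≤m+n (count f b) _)
... | inj₂ refl = ≤-refl

count-true : ∀ k → count (λ _ → true) k ≡ k
count-true zero = refl
count-true (suc k) = trans (cong (_+ 1) (count-true k)) (+-comm k 1)

count-≤? : ∀ c k → count (λ β → does (c ≤? β)) k ≡ k ∸ c
count-≤? c zero = sym (0∸n≡0 c)
count-≤? c (suc k) with c ≤? k
... | yes c≤k rewrite dec-true (c ≤? k) c≤k =
  trans (cong (_+ 1) (count-≤? c k)) (trans (+-comm (k ∸ c) 1) (sym (+-∸-assoc 1 c≤k)))
... | no c≰k rewrite dec-false (c ≤? k) c≰k =
  trans (+-identityʳ _) (trans (count-≤? c k) (trans (m≤n⇒m∸n≡0 (<⇒≤ k<c)) (sym (m≤n⇒m∸n≡0 k<c))))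
  where
  k<c : k < c
  k<c = ≰⇒> c≰k

length-filter-∷ : ∀ {P : Pred ℕ 0ℓ} (P? : Decidable P) x xs →
  length (filter P? (x ∷ xs)) ≡ 𝟙 (does (P? x)) + length (filter P? xs)
length-filter-∷ P? x xs with does (P? x)
... | true = refl
... | false = refl

length-filter-upTo : ∀ {P : Pred ℕ 0ℓ} (P? : Decidable P) k →
  length (filter P? (upTo k)) ≡ count (does ∘ P?) k
length-filter-upTo P? zero = refl
length-filter-upTo P? (suc k) = begin-equality
  length (filter P? (upTo (suc k)))                          ≡⟨ cong (length ∘ filter P?) (upTo-∷ʳ k) ⟨
  length (filter P? (upTo k ++ [ k ]))                       ≡⟨ cong length (filter-++ P? (upTo k) [ k ]) ⟩
  length (filter P? (upTo k) ++ filter P? [ k ])             ≡⟨ length-++ (filter P? (upTo k)) ⟩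
  length (filter P? (upTo k)) + length (filter P? [ k ])
    ≡⟨ cong₂ _+_ (length-filter-upTo P? k) (length-filter-∷ P? k []) ⟩
  count (does ∘ P?) k + (𝟙 (does (P? k)) + 0)                ≡⟨ cong (count (does ∘ P?) k +_) (+-identityʳ _) ⟩
  count (does ∘ P?) (suc k)                                  ∎

Sorted : List ℕ → Set
Sorted = AllPairs _≤_

rank : List ℕ → ℕ → ℕ
rank [] a = 0
rank (x ∷ xs) a = 𝟙 (does (x <? a)) + rank xs a

rank-mono : ∀ xs {a b} → a ≤ b → rank xs a ≤ rank xs b
rank-mono [] _ = z≤n
rank-mono (x ∷ xs) {a} {b} a≤b =
  +-mono-≤ (𝟙-does-mono (x <? a) (x <? b) (λ x<a → <-≤-trans x<a a≤b)) (rank-mono xs a≤b)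

rank≡0 : ∀ {a} xs → All (a ≤_) xs → rank xs a ≡ 0
rank≡0 [] [] = refl
rank≡0 {a} (x ∷ xs) (a≤x ∷ a≤xs) rewrite dec-false (x <? a) (≤⇒≯ a≤x) = rank≡0 xs a≤xs

rank-++ : ∀ xs ys a → rank (xs ++ ys) a ≡ rank xs a + rank ys a
rank-++ [] ys a = refl
rank-++ (x ∷ xs) ys a = trans (cong (𝟙 (does (x <? a)) +_) (rank-++ xs ys a))
  (sym (+-assoc (𝟙 (does (x <? a))) (rank xs a) (rank ys a)))

rank-upTo : ∀ n a → rank (upTo n) a ≡ n ⊓ a
rank-upTo zero a = refl
rank-upTo (suc n) a = begin-equality
  rank (upTo (suc n)) a                  ≡⟨ cong (λ xs → rank xs a) (upTo-∷ʳ n) ⟨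
  rank (upTo n ++ [ n ]) a               ≡⟨ rank-++ (upTo n) [ n ] a ⟩
  rank (upTo n) a + rank [ n ] a         ≡⟨ cong₂ _+_ (rank-upTo n a) (+-identityʳ _) ⟩
  n ⊓ a + 𝟙 (does (n <? a))              ≡⟨ last (n <? a) ⟩
  suc n ⊓ a                              ∎
  where
  last : (n<a? : Dec (n < a)) → n ⊓ a + 𝟙 (does n<a?) ≡ suc n ⊓ a
  last (yes n<a) rewrite m≤n⇒m⊓n≡m (<⇒≤ n<a) | m≤n⇒m⊓n≡m n<a = +-comm n 1
  last (no n≮a) rewrite m≥n⇒m⊓n≡n (≮⇒≥ n≮a) | m≥n⇒m⊓n≡n (m≤n⇒m≤1+n (≮⇒≥ n≮a)) =
    +-identityʳ a

All-kth : ∀ {P : ℕ → Set} {xs} k → All P xs → k < length xs → P (kth k xs)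
All-kth zero (px ∷ _) _ = px
All-kth (suc k) (_ ∷ pxs) k<len = All-kth k pxs (s≤s⁻¹ k<len)

rank-kth : ∀ {xs} k → Sorted xs → k < length xs →
  rank xs (kth k xs) ≤ k × k < rank xs (suc (kth k xs))
rank-kth {x ∷ xs} zero (x≤xs ∷ _) _
  rewrite dec-false (x <? x) (n≮n x) | rank≡0 xs x≤xs | dec-true (x <? suc x) (n<1+n x) = z≤n , s≤s z≤n
rank-kth {x ∷ xs} (suc k) (x≤xs ∷ sorted) k<len
  rewrite dec-true (x <? suc (kth k xs)) (s≤s (All-kth k x≤xs (s≤s⁻¹ k<len))) =
  +-mono-≤ (𝟙≤1 _) (proj₁ IH) , s≤s (proj₂ IH)
  where
  IH : rank xs (kth k xs) ≤ k × k < rank xs (suc (kth k xs))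
  IH = rank-kth k sorted (s≤s⁻¹ k<len)

kth-unique : ∀ {xs a} k → Sorted xs → k < length xs →
  rank xs a ≤ k → k < rank xs (suc a) → kth k xs ≡ a
kth-unique {xs} {a} k sorted k<len ra≤k k<ra′ with <-cmp (kth k xs) a
... | tri< x<a _ _ = contradiction (≤-trans (rank-mono xs x<a) ra≤k) (<⇒≱ (proj₂ (rank-kth k sorted k<len)))
... | tri≈ _ x≡a _ = x≡a
... | tri> _ _ a<x = contradiction (≤-trans (rank-mono xs a<x) (proj₁ (rank-kth k sorted k<len))) (<⇒≱ k<ra′)

length-insertSorted : ∀ y xs → length (insertSorted y xs) ≡ suc (length xs)
length-insertSorted y [] = refl
length-insertSorted y (x ∷ xs) with y ≤? x
... | yes _ = refl
... | no _ = cong suc (length-insertSorted y xs)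

length-removeKth : ∀ k xs → k < length xs → suc (length (removeKth k xs)) ≡ length xs
length-removeKth zero (x ∷ xs) _ = refl
length-removeKth (suc k) (x ∷ xs) k<len = cong suc (length-removeKth k xs (s≤s⁻¹ k<len))

rank-insertSorted : ∀ y xs a → rank (insertSorted y xs) a ≡ 𝟙 (does (y <? a)) + rank xs a
rank-insertSorted y [] a = refl
rank-insertSorted y (x ∷ xs) a with y ≤? x
... | yes _ = refl
... | no _ = trans (cong (𝟙 (does (x <? a)) +_) (rank-insertSorted y xs a))
  (x∙yz≈y∙xz (𝟙 (does (x <? a))) (𝟙 (does (y <? a))) (rank xs a))

rank-removeKth : ∀ k xs a → k < length xs →
  rank xs a ≡ 𝟙 (does (kth k xs <? a)) + rank (removeKth k xs) a
rank-removeKth zero (x ∷ xs) a _ = refl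
rank-removeKth (suc k) (x ∷ xs) a k<len =
  trans (cong (𝟙 (does (x <? a)) +_) (rank-removeKth k xs a (s≤s⁻¹ k<len)))
        (x∙yz≈y∙xz (𝟙 (does (x <? a))) (𝟙 (does (kth k xs <? a))) (rank (removeKth k xs) a))

All-insertSorted : ∀ {P : ℕ → Set} {y} xs → P y → All P xs → All P (insertSorted y xs)
All-insertSorted [] py [] = py ∷ []
All-insertSorted {y = y} (x ∷ xs) py (px ∷ pxs) with y ≤? x
... | yes _ = py ∷ px ∷ pxs
... | no _ = px ∷ All-insertSorted xs py pxs

All-removeKth : ∀ {P : ℕ → Set} k {xs} → All P xs → All P (removeKth k xs)
All-removeKth _ [] = []
All-removeKth zero (_ ∷ pxs) = pxs
All-removeKth (suc k) (px ∷ pxs) = px ∷ All-removeKth k pxs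

insertSorted-sorted : ∀ y {xs} → Sorted xs → Sorted (insertSorted y xs)
insertSorted-sorted y [] = [] ∷ []
insertSorted-sorted y {x ∷ xs} (x≤xs ∷ sorted) with y ≤? x
... | yes y≤x = (y≤x ∷ All.map (≤-trans y≤x) x≤xs) ∷ x≤xs ∷ sorted
... | no y≰x = All-insertSorted xs (<⇒≤ (≰⇒> y≰x)) x≤xs ∷ insertSorted-sorted y sorted

removeKth-sorted : ∀ k {xs} → Sorted xs → Sorted (removeKth k xs)
removeKth-sorted _ [] = []
removeKth-sorted zero (_ ∷ sorted) = sorted
removeKth-sorted (suc k) (x≤xs ∷ sorted) = All-removeKth k x≤xs ∷ removeKth-sorted k sorted

Placeable : (m : ℕ) → (ℕ → ℕ) → (ℕ → ℕ) → ℕ → ℕ → Set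
Placeable m q pos α i = Unoccupied pos α i × Admissible m q pos α i

countAbove-cong : ∀ m {pos pos′} α i → (∀ β → β < α → pos β ≡ pos′ β) →
  countAbove m pos α i ≡ countAbove m pos′ α i
countAbove-cong m α i agree = trans (length-filter-upTo _ α)
  (trans (count-cong α (λ β β<α → cong (λ p → does (α <? β + m) ∧ does (i <? p)) (agree β β<α)))
         (sym (length-filter-upTo _ α)))

placeable-cong : ∀ {m q pos pos′ α i} → 0 < m → (∀ β → β < α → pos β ≡ pos′ β) →
  Placeable m q pos α i → Placeable m q pos′ α i
placeable-cong {m} {α = α} {i} 0<m agree (unoccupied , earlier , q≡countAbove) =
  (λ β β<α → unoccupied β β<α ∘ trans (agree β β<α)) ,
  (λ m≤α → subst (_< i) (agree (α ∸ m) (∸-monoʳ-< {α} {m} {0} 0<m m≤α)) (earlier m≤α)) ,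
  trans q≡countAbove (countAbove-cong m α i agree)

Alg1Run-unique : ∀ {m q pos pos′} → 0 < m → Alg1Run m q pos → Alg1Run m q pos′ →
  ∀ α → pos α ≡ pos′ α
Alg1Run-unique {m} {q} {pos} {pos′} 0<m run run′ = <-rec (λ α → pos α ≡ pos′ α) step
  where
  placed : ∀ {p} → Alg1Run m q p → ∀ α → Placeable m q p α (p α)
  placed runₚ α = proj₁ (runₚ α) , proj₁ (proj₂ (runₚ α))
  leftmost : ∀ {p} → Alg1Run m q p → ∀ α i → i < p α → ¬ Placeable m q p α i
  leftmost runₚ α i i<pα = uncurry (proj₂ (proj₂ (runₚ α)) i i<pα)
  step : ∀ α → (∀ {β} → β < α → pos β ≡ pos′ β) → pos α ≡ pos′ α
  step α agree with <-cmp (pos α) (pos′ α)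
  ... | tri< p<p′ _ _ =
    contradiction (placeable-cong {q = q} 0<m (λ β → agree) (placed run α)) (leftmost run′ α (pos α) p<p′)
  ... | tri≈ _ p≡p′ _ = p≡p′
  ... | tri> _ _ p′<p =
    contradiction (placeable-cong {q = q} 0<m (λ β → sym ∘ agree) (placed run′ α)) (leftmost run α (pos′ α) p′<p)

module Algorithm₂ (m : ℕ) (0<m : 0 < m) (q : ℕ → ℕ) (q<m : ∀ i → q i < m) where

  S : ℕ → List ℕ
  S = S₂ m q

  V : ℕ → ℕ
  V = V₂ m q

  length-S : ∀ i → length (S i) ≡ m
  q<length-S : ∀ i → q i < length (S i)

  length-S zero = length-upTo m
  length-S (suc i) = begin-equality
    length (insertSorted (V i + m) (removeKth (q i) (S i)))
      ≡⟨ length-insertSorted (V i + m) (removeKth (q i) (S i)) ⟩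
    suc (length (removeKth (q i) (S i)))
      ≡⟨ length-removeKth (q i) (S i) (q<length-S i) ⟩
    length (S i)
      ≡⟨ length-S i ⟩
    m ∎

  q<length-S i = subst (q i <_) (sym (length-S i)) (q<m i)

  S-sorted : ∀ i → Sorted (S i)
  S-sorted zero = AllPairs.applyUpTo⁺₁ id m (λ i<j _ → <⇒≤ i<j)
  S-sorted (suc i) = insertSorted-sorted (V i + m) (removeKth-sorted (q i) (S-sorted i))

  V-rank-bounds : ∀ i → rank (S i) (V i) ≤ q i × q i < rank (S i) (suc (V i))
  V-rank-bounds i = rank-kth (q i) (S-sorted i) (q<length-S i)

  unused : ℕ → ℕ → Bool
  unused zero β = true
  unused (suc i) β = unused i β ∧ not (does (V i ≟ β))

  unused-suc : ∀ i {β} → V i ≢ β → unused (suc i) β ≡ unused i β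
  unused-suc i {β} Vi≢β rewrite dec-false (V i ≟ β) Vi≢β = ∧-identityʳ (unused i β)

  unused-suc-V : ∀ i → unused (suc i) (V i) ≡ false
  unused-suc-V i rewrite dec-true (V i ≟ V i) refl = ∧-zeroʳ (unused i (V i))

  unused-antitone : ∀ i {β} → unused (suc i) β ≡ true → unused i β ≡ true
  unused-antitone i {β} fresh with unused i β
  ... | true = refl
  ... | false = fresh

  V-used : ∀ {i j} → j < i → unused i (V j) ≡ false
  V-used {suc i} {j} j<1+i with m≤n⇒m<n∨m≡n (m<1+n⇒m≤n j<1+i)
  ... | inj₁ j<i rewrite V-used j<i = refl
  ... | inj₂ refl = unused-suc-V j

  unused-true : ∀ {i β} → (∀ j → j < i → V j ≢ β) → unused i β ≡ true
  unused-true {zero} _ = refl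
  unused-true {suc i} fresh =
    trans (unused-suc i (fresh i (n<1+n i))) (unused-true (λ j j<i → fresh j (m<n⇒m<1+n j<i)))

  unused-false : ∀ {i β} → unused i β ≡ false → ∃[ j ] j < i × V j ≡ β
  unused-false {suc i} {β} used with V i ≟ β
  ... | yes Vi≡β = i , n<1+n i , Vi≡β
  ... | no Vi≢β with unused-false (trans (sym (unused-suc i Vi≢β)) used)
  ...   | j , j<i , Vj≡β = j , m<n⇒m<1+n j<i , Vj≡β

  count-unused-suc : ∀ i → unused i (V i) ≡ true → ∀ (h : ℕ → Bool) k →
    count (λ β → h β ∧ unused i β) k
      ≡ count (λ β → h β ∧ unused (suc i) β) k + 𝟙 (h (V i) ∧ does (V i <? k))
  count-unused-suc i fresh h k with V i <? k
  ... | yes Vi<k rewrite dec-true (V i <? k) Vi<k =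
    trans (count-remove k Vi<k
            (trans (cong (h (V i) ∧_) (unused-suc-V i)) (∧-zeroʳ (h (V i))))
            (λ β β≢Vi → cong (h β ∧_) (unused-suc i (≢-sym β≢Vi))))
          (cong (λ b → count (λ β → h β ∧ unused (suc i) β) k + 𝟙 (h (V i) ∧ b)) fresh)
  ... | no Vi≮k rewrite dec-false (V i <? k) Vi≮k | ∧-zeroʳ (h (V i)) =
    trans (count-cong k (λ β β<k → cong (h β ∧_) (sym (unused-suc i (Vi≢β β<k))))) (sym (+-identityʳ _))
    where
    Vi≢β : ∀ {β} → β < k → V i ≢ β
    Vi≢β β<k Vi≡β = Vi≮k (subst (_< k) (sym Vi≡β) β<k)

  window : ℕ → ℕ → ℕ
  window i α = count (λ β → does (α ≤? β + m) ∧ unused i β) α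

  blocked : ℕ → ℕ → Bool
  blocked i α = does (m ≤? α) ∧ unused i (α ∸ m)

  openWindow : ℕ → ℕ → ℕ
  openWindow i α = count (λ β → does (α <? β + m) ∧ unused i β) α

  window-suc-top : ∀ i α → window i (suc α) ≡ openWindow i α + 𝟙 (unused i α)
  window-suc-top i α rewrite dec-true (α <? α + m) (m<m+n α 0<m) = refl

  window-drop : ∀ i α → window i α ≡ openWindow i α + 𝟙 (blocked i α)
  window-drop i α with m ≤? α
  ... | no m≰α rewrite dec-false (m ≤? α) m≰α =
    trans (count-cong α (λ β _ → cong (_∧ unused i β) (sym (<?≡≤? (α≢β+m β))))) (sym (+-identityʳ _))
    where
    α≢β+m : ∀ β → α ≢ β + m
    α≢β+m β α≡β+m = m≰α (subst (m ≤_) (sym α≡β+m) (m≤n+m m β))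
  ... | yes m≤α rewrite dec-true (m ≤? α) m≤α =
    trans (count-remove α (∸-monoʳ-< {α} {m} {0} 0<m m≤α) leaving-false agree)
          (cong (λ b → openWindow i α + 𝟙 (b ∧ unused i (α ∸ m)))
                (dec-true (α ≤? α ∸ m + m) (≤-reflexive (sym α∸m+m≡α))))
    where
    α∸m+m≡α : α ∸ m + m ≡ α
    α∸m+m≡α = m∸n+n≡m m≤α
    leaving-false : does (α <? α ∸ m + m) ∧ unused i (α ∸ m) ≡ false
    leaving-false rewrite α∸m+m≡α | dec-false (α <? α) (n≮n α) = refl
    agree : ∀ β → β ≢ α ∸ m → does (α <? β + m) ∧ unused i β ≡ does (α ≤? β + m) ∧ unused i β
    agree β β≢α∸m = cong (_∧ unused i β)
      (<?≡≤? (λ α≡β+m → β≢α∸m (sym (trans (cong (_∸ m) α≡β+m) (m+n∸n≡m β m)))))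

  window-unblocked : ∀ {i α} → blocked i α ≡ false → window i α ≡ openWindow i α
  window-unblocked {i} {α} free =
    trans (window-drop i α) (trans (cong (λ b → openWindow i α + 𝟙 b) free) (+-identityʳ (openWindow i α)))

  window-suc : ∀ i α → window i (suc α) + 𝟙 (blocked i α) ≡ window i α + 𝟙 (unused i α)
  window-suc i α = begin-equality
    window i (suc α) + 𝟙 (blocked i α)                 ≡⟨ cong (_+ 𝟙 (blocked i α)) (window-suc-top i α) ⟩
    openWindow i α + 𝟙 (unused i α) + 𝟙 (blocked i α)  ≡⟨ xy∙z≈xz∙y (openWindow i α) _ _ ⟩
    openWindow i α + 𝟙 (blocked i α) + 𝟙 (unused i α)  ≡⟨ cong (_+ 𝟙 (unused i α)) (window-drop i α) ⟨
    window i α + 𝟙 (unused i α)                        ∎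

  Selected : ℕ → ℕ → Set
  Selected i α = unused i α ≡ true × blocked i α ≡ false × window i α ≡ q i

  RankInvariant : ℕ → Set
  RankInvariant i = ∀ α → rank (S i) α ≡ window i α

  selected : ∀ i → RankInvariant i → Selected i (V i)
  selected i inv = 𝟙-jump (unused i (V i)) (blocked i (V i)) (window-suc i (V i))
    (subst (_≤ q i) (inv (V i)) (proj₁ (V-rank-bounds i)))
    (subst (q i <_) (inv (suc (V i))) (proj₂ (V-rank-bounds i)))

  rankInvariant-zero : RankInvariant 0
  rankInvariant-zero α = begin-equality
    rank (upTo m) α                    ≡⟨ rank-upTo m α ⟩
    m ⊓ α                              ≡⟨ m+n∸n≡m (m ⊓ α) (α ∸ m) ⟨
    m ⊓ α + (α ∸ m) ∸ (α ∸ m)          ≡⟨ cong (_∸ (α ∸ m)) (m⊓n+n∸m≡n m α) ⟩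
    α ∸ (α ∸ m)                        ≡⟨ count-≤? (α ∸ m) α ⟨
    count (λ β → does (α ∸ m ≤? β)) α  ≡⟨ count-cong α (λ β _ → trans (in-window β) (sym (∧-identityʳ _))) ⟩
    window 0 α                         ∎
    where
    in-window : ∀ β → does (α ∸ m ≤? β) ≡ does (α ≤? β + m)
    in-window β = does-cong (α ∸ m ≤? β) (α ≤? β + m)
      (λ α∸m≤β → ≤-trans (m≤n+m∸n α m)
                         (subst (m + (α ∸ m) ≤_) (+-comm m β) (+-monoʳ-≤ m α∸m≤β)))
      (λ α≤β+m → m≤n+o⇒m∸n≤o α m (subst (α ≤_) (+-comm β m) α≤β+m))

  rankInvariant-suc : ∀ i → RankInvariant i → RankInvariant (suc i)
  rankInvariant-suc i inv α = +-cancelˡ-≡ (𝟙 Vi-in-window) _ _ (begin-equality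
    𝟙 Vi-in-window + rank (S (suc i)) α
      ≡⟨ cong (𝟙 Vi-in-window +_) (rank-insertSorted (V i + m) R α) ⟩
    𝟙 Vi-in-window + (𝟙 (does (V i + m <? α)) + rank R α)
      ≡⟨ +-assoc (𝟙 Vi-in-window) _ (rank R α) ⟨
    𝟙 Vi-in-window + 𝟙 (does (V i + m <? α)) + rank R α
      ≡⟨ cong (_+ rank R α) split ⟨
    𝟙 (does (V i <? α)) + rank R α
      ≡⟨ rank-removeKth (q i) (S i) α (q<length-S i) ⟨
    rank (S i) α
      ≡⟨ inv α ⟩
    window i α
      ≡⟨ count-unused-suc i (proj₁ (selected i inv)) (λ β → does (α ≤? β + m)) α ⟩
    window (suc i) α + 𝟙 Vi-in-window
      ≡⟨ +-comm (window (suc i) α) (𝟙 Vi-in-window) ⟩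
    𝟙 Vi-in-window + window (suc i) α
      ∎)
    where
    R : List ℕ
    R = removeKth (q i) (S i)
    Vi-in-window : Bool
    Vi-in-window = does (α ≤? V i + m) ∧ does (V i <? α)
    split : 𝟙 (does (V i <? α)) ≡ 𝟙 Vi-in-window + 𝟙 (does (V i + m <? α))
    split = 𝟙-<-split (V i <? α) (α ≤? V i + m) (V i + m <? α) (m≤m+n (V i) m)

  rankInvariant : ∀ i → RankInvariant i
  rankInvariant zero = rankInvariant-zero
  rankInvariant (suc i) = rankInvariant-suc i (rankInvariant i)

  V-selected : ∀ i → Selected i (V i)
  V-selected i = selected i (rankInvariant i)

  selected⇒V : ∀ {i α} → Selected i α → V i ≡ α
  selected⇒V {i} {α} (fresh , free , window≡q) = kth-unique (q i) (S-sorted i) (q<length-S i)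
    (≤-reflexive (trans (rankInvariant i α) window≡q))
    (≤-reflexive (sym (trans (rankInvariant i (suc α)) window-suc≡)))
    where
    window-suc≡ : window i (suc α) ≡ suc (q i)
    window-suc≡ = begin-equality
      window i (suc α)                    ≡⟨ +-identityʳ _ ⟨
      window i (suc α) + 𝟙 false          ≡⟨ cong (λ b → window i (suc α) + 𝟙 b) free ⟨
      window i (suc α) + 𝟙 (blocked i α)  ≡⟨ window-suc i α ⟩
      window i α + 𝟙 (unused i α)         ≡⟨ cong₂ (λ w b → w + 𝟙 b) window≡q fresh ⟩
      q i + 1                             ≡⟨ +-comm (q i) 1 ⟩
      suc (q i)                           ∎

  V-fresh : ∀ i → unused i (V i) ≡ true
  V-fresh i = proj₁ (V-selected i)

  V-distinct : ∀ {i j} → i < j → V i ≢ V j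
  V-distinct {i} {j} i<j Vi≡Vj with trans (sym (V-used i<j)) (trans (cong (unused j) Vi≡Vj) (V-fresh j))
  ... | ()

  V-injective : ∀ {i j} → V i ≡ V j → i ≡ j
  V-injective {i} {j} Vi≡Vj with <-cmp i j
  ... | tri< i<j _ _ = contradiction Vi≡Vj (V-distinct i<j)
  ... | tri≈ _ i≡j _ = i≡j
  ... | tri> _ _ j<i = contradiction (sym Vi≡Vj) (V-distinct j<i)

  unused⇒V≤ : ∀ {i α} → unused i α ≡ true → q i ≡ 0 → V i ≤ α
  unused⇒V≤ {i} {α} fresh q≡0 = ≮⇒≥ λ α<Vi → contradiction (begin
    1                                                                  ≡⟨ cong 𝟙 fresh ⟨
    𝟙 (unused i α)                                                     ≤⟨ m≤n+m _ _ ⟩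
    openWindow i α + 𝟙 (unused i α)                                    ≡⟨ window-suc-top i α ⟨
    window i (suc α)                                                   ≡⟨ rankInvariant i (suc α) ⟨
    rank (S i) (suc α)                                                 ≤⟨ rank-mono (S i) α<Vi ⟩
    rank (S i) (V i)                                                   ≤⟨ proj₁ (V-rank-bounds i) ⟩
    q i                                                                ≡⟨ q≡0 ⟩
    0                                                                  ∎) λ ()

  zeros : ℕ → ℕ
  zeros i = count (λ j → does (q j ≟ 0)) i

  -- each zero of q before step i used up a distinct value ≤ α (by unused⇒V≤)
  unused-count-bound : ∀ {α} i → unused i α ≡ true → count (unused i) (suc α) + zeros i ≤ suc α
  unused-count-bound {α} zero _ = ≤-reflexive (trans (+-identityʳ _) (count-true (suc α)))
  unused-count-bound {α} (suc i) fresh = begin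
    count (unused (suc i)) (suc α) + (zeros i + 𝟙 (does (q i ≟ 0)))
      ≡⟨ x∙yz≈xz∙y (count (unused (suc i)) (suc α)) (zeros i) (𝟙 (does (q i ≟ 0))) ⟩
    count (unused (suc i)) (suc α) + 𝟙 (does (q i ≟ 0)) + zeros i
      ≤⟨ +-monoˡ-≤ (zeros i) (+-monoʳ-≤ _ zero⇒V≤α) ⟩
    count (unused (suc i)) (suc α) + 𝟙 (does (V i <? suc α)) + zeros i
      ≡⟨ cong (_+ zeros i) (count-unused-suc i (V-fresh i) (λ _ → true) (suc α)) ⟨
    count (unused i) (suc α) + zeros i
      ≤⟨ unused-count-bound i (unused-antitone i fresh) ⟩
    suc α
      ∎
    where
    zero⇒V≤α : 𝟙 (does (q i ≟ 0)) ≤ 𝟙 (does (V i <? suc α))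
    zero⇒V≤α = 𝟙-does-mono (q i ≟ 0) (V i <? suc α) (s≤s ∘ unused⇒V≤ (unused-antitone i fresh))

  zeros-unbounded : (∀ t → ∃[ i ] t ≤ i × q i ≡ 0) → ∀ k → ∃[ i ] k ≤ zeros i
  zeros-unbounded _ zero = 0 , z≤n
  zeros-unbounded often (suc k) with zeros-unbounded often k
  ... | i , k≤zeros-i with often i
  ...   | j , i≤j , qj≡0 = suc j , (begin
    suc k            ≤⟨ s≤s (≤-trans k≤zeros-i (count-mono _ i≤j)) ⟩
    suc (zeros j)    ≡⟨ +-comm (zeros j) 1 ⟨
    zeros j + 1      ≡⟨ cong (λ b → zeros j + 𝟙 b) (dec-true (q j ≟ 0) qj≡0) ⟨
    zeros (suc j)    ∎)

  V-surjective : (∀ t → ∃[ i ] t ≤ i × q i ≡ 0) → ∀ α → ∃[ i ] V i ≡ α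
  V-surjective often α with zeros-unbounded often (2 + α)
  ... | N , 2+α≤zeros-N with unused N α in eq
  ...   | false = let j , _ , Vj≡α = unused-false {N} eq in j , Vj≡α
  ...   | true = contradiction
    (≤-trans 2+α≤zeros-N (≤-trans (m≤n+m (zeros N) _) (unused-count-bound N eq))) (n≮n (suc α))

  module Inverse (often : ∀ t → ∃[ i ] t ≤ i × q i ≡ 0) where

    pos : ℕ → ℕ
    pos α = proj₁ (V-surjective often α)

    V∘pos : ∀ α → V (pos α) ≡ α
    V∘pos α = proj₂ (V-surjective often α)

    pos∘V : ∀ i → pos (V i) ≡ i
    pos∘V i = V-injective (V∘pos (V i))

    unused≡ : ∀ i β → unused i β ≡ does (i ≤? pos β)
    unused≡ i β with i ≤? pos β
    ... | yes i≤pos rewrite dec-true (i ≤? pos β) i≤pos = unused-true λ j j<i Vj≡β →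
      <⇒≱ j<i (subst (i ≤_) (trans (cong pos (sym Vj≡β)) (pos∘V j)) i≤pos)
    ... | no i≰pos rewrite dec-false (i ≤? pos β) i≰pos =
      trans (cong (unused i) (sym (V∘pos β))) (V-used (≰⇒> i≰pos))

    not-blocked⇔ : ∀ i α → blocked i α ≡ false ⇔ (m ≤ α → pos (α ∸ m) < i)
    not-blocked⇔ i α rewrite unused≡ i (α ∸ m) with m ≤? α | i ≤? pos (α ∸ m)
    ... | yes m≤α | yes i≤pos rewrite dec-true (m ≤? α) m≤α | dec-true (i ≤? pos (α ∸ m)) i≤pos =
      mk⇔ (λ ()) (λ earlier → contradiction i≤pos (<⇒≱ (earlier m≤α)))
    ... | yes m≤α | no i≰pos rewrite dec-true (m ≤? α) m≤α | dec-false (i ≤? pos (α ∸ m)) i≰pos =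
      mk⇔ (λ _ _ → ≰⇒> i≰pos) (λ _ → refl)
    ... | no m≰α | _ rewrite dec-false (m ≤? α) m≰α =
      mk⇔ (λ _ m≤α → contradiction m≤α m≰α) (λ _ → refl)

    countAbove≡openWindow : ∀ {α i} → Unoccupied pos α i → countAbove m pos α i ≡ openWindow i α
    countAbove≡openWindow {α} {i} unoccupied = trans (length-filter-upTo _ α) (count-cong α agree)
      where
      agree : ∀ β → β < α → does (α <? β + m) ∧ does (i <? pos β) ≡ does (α <? β + m) ∧ unused i β
      agree β β<α =
        cong (does (α <? β + m) ∧_) (trans (<?≡≤? (≢-sym (unoccupied β β<α))) (sym (unused≡ i β)))

    admissible⇔selected : ∀ {α i} → i ≤ pos α → Unoccupied pos α i →
      Admissible m q pos α i ⇔ Selected i α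
    admissible⇔selected {α} {i} i≤pos unoccupied = mk⇔
      (λ (earlier , q≡countAbove) →
        let free = Equivalence.from (not-blocked⇔ i α) earlier in
        fresh , free , trans (window≡countAbove free) (sym q≡countAbove))
      (λ (_ , free , window≡q) →
        Equivalence.to (not-blocked⇔ i α) free , trans (sym window≡q) (window≡countAbove free))
      where
      fresh : unused i α ≡ true
      fresh = trans (unused≡ i α) (dec-true (i ≤? pos α) i≤pos)
      window≡countAbove : blocked i α ≡ false → window i α ≡ countAbove m pos α i
      window≡countAbove free = trans (window-unblocked {i} free) (sym (countAbove≡openWindow unoccupied))

    pos-run : Alg1Run m q pos
    pos-run α = unoccupied , Equivalence.from (admissible⇔selected ≤-refl unoccupied) selected-at-pos , leftmost
      where
      unoccupied : Unoccupied pos α (pos α)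
      unoccupied β β<α pos-β≡pos-α =
        <⇒≢ β<α (trans (sym (V∘pos β)) (trans (cong V pos-β≡pos-α) (V∘pos α)))
      selected-at-pos : Selected (pos α) α
      selected-at-pos = subst (Selected (pos α)) (V∘pos α) (V-selected (pos α))
      leftmost : ∀ i → i < pos α → Unoccupied pos α i → ¬ Admissible m q pos α i
      leftmost i i<pos unoccupied-i admissible = <⇒≢ i<pos (trans (sym (pos∘V i)) (cong pos Vi≡α))
        where
        Vi≡α : V i ≡ α
        Vi≡α = selected⇒V (Equivalence.to (admissible⇔selected (<⇒≤ i<pos) unoccupied-i) admissible)

parking⇒zero : ∀ {m n} {p : Fin n → Fin m} → 0 < m → 0 < n → IsParking m n p → ∃[ j ] toℕ (p j) ≡ 0
parking⇒zero {m} {n} {p} 0<m 0<n parking with any? (λ j → toℕ (p j) ≟ 0)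
... | yes found = found
... | no none = contradiction
  (subst₂ _≤_ (*-identityˡ n) (trans (cong (m *_) countBelow-1≡0) (*-zeroʳ m)) (parking 1 ≤-refl 0<m))
  (<⇒≱ 0<n)
  where
  countBelow-1≡0 : countBelow p 1 ≡ 0
  countBelow-1≡0 = cong length (filter-none (λ j → suc (toℕ (p j)) ≤? 1)
    (All.universal (λ j pj<1 → none (j , n≤0⇒n≡0 (s≤s⁻¹ pj<1))) (allFin n)))

pext-periodic : ∀ {m} n .{{_ : NonZero n}} (p : Fin n → Fin m) j t → pext n p (toℕ j + t * n) ≡ toℕ (p j)
pext-periodic n p j t = cong (toℕ ∘ p) (toℕ-injective (begin-equality
  toℕ ((toℕ j + t * n) mod n)  ≡⟨ toℕ-fromℕ< _ ⟩
  (toℕ j + t * n) % n          ≡⟨ [m+kn]%n≡m%n (toℕ j) t n ⟩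
  toℕ j % n                    ≡⟨ m<n⇒m%n≡m (toℕ<n j) ⟩
  toℕ j                        ∎))

pext-zeros-recur : ∀ {m} n .{{_ : NonZero n}} (p : Fin n → Fin m) → ∃[ j ] toℕ (p j) ≡ 0 →
  ∀ t → ∃[ i ] t ≤ i × pext n p i ≡ 0
pext-zeros-recur n p (j , pj≡0) t =
  toℕ j + t * n , ≤-trans (m≤m*n t n) (m≤n+m (t * n) (toℕ j)) , trans (pext-periodic n p j t) pj≡0

mainTheorem19 : (m n : ℕ) → .{{_ : NonZero m}} → .{{_ : NonZero n}} →
    (p : Fin n → Fin m) → IsParking m n p →
    Σ (ℕ → ℕ) (λ pos → Alg1Run m (pext n p) pos)
    × (∀ pos → Alg1Run m (pext n p) pos → ∀ i → pos (V₂ m (pext n p) i) ≡ i)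
mainTheorem19 m n p parking =
  (pos , pos-run) , λ pos′ run′ i → trans (Alg1Run-unique 0<m run′ pos-run (V i)) (pos∘V i)
  where
  0<m : 0 < m
  0<m = >-nonZero⁻¹ m
  open Algorithm₂ m 0<m (pext n p) (λ i → toℕ<n (p (i mod n)))
  open Inverse (pext-zeros-recur n p (parking⇒zero 0<m (>-nonZero⁻¹ n) parking))
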